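{- Let $G$ be a finite abelian group and $n$ an odd positive integer. For each $g \in G$ let $P_g = \{(g,x) : x \in \mathbb{Z}_n\} \subseteq G \times \mathbb{Z}_n$. Let $c$ be a coloring of $G \times \mathbb{Z}_n$ such that $|c(P_g)| \le |c(P_0)|$ for all $g \in G$ (where $0$ is the identity of $G$). If $G \times \mathbb{Z}_n$ contains no rainbow 3-AP under $c$, then $|c(P_g) \setminus c(P_0)| \le 1$ for all $g \in G$.
   Context: $\mathbb{Z}_n$ is the cyclic group $\{0,\dots,n-1\}$ under addition mod $n$. A 3-term arithmetic progression (3-AP) in an abelian group $H$ is a sequence $a, a+d, a+2d$ with $a,d \in H$. A coloring of $H$ is a function $c$ from $H$ to a finite set of colors; for $P \subseteq H$, $c(P)=\{c(x): x\in P\}$. A 3-AP is rainbow under $c$ if its three terms receive three pairwise distinct colors. -}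

module Defs where

open import Level using (Level)
open import Data.Nat using (ℕ; NonZero; _%_)
import Data.Nat as ℕ
open import Data.Nat.DivMod using (_mod_)
open import Data.Fin using (Fin; toℕ; _≟_)
open import Data.Fin.Properties using (any?)
open import Data.Fin.Subset using (Subset; _∩_; ∁)
open import Data.Vec using (tabulate)
open import Data.Product using (Σ; ∃; _×_; _,_)
open import Relation.Nullary using (¬_; does)
open import Relation.Binary.PropositionalEquality using (_≡_)
open import Algebra.Bundles using (AbelianGroup)

_+ₙ_ : ∀ {n} .{{_ : NonZero n}} → Fin n → Fin n → Fin n
_+ₙ_ {n} a b = (toℕ a ℕ.+ toℕ b) mod n

image : ∀ {m k} → (Fin m → Fin k) → Subset k
image f = tabulate (λ j → does (any? (λ x → f x ≟ j)))

_∖_ : ∀ {k} → Subset k → Subset k → Subset k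
s ∖ t = s ∩ ∁ t

module _ {a ℓ : Level} (G : AbelianGroup a ℓ) where
  open AbelianGroup G

  IsFinite : Set (a Level.⊔ ℓ)
  IsFinite = Σ ℕ λ m → Σ (Fin m → Carrier) λ e → ∀ g → ∃ λ i → e i ≈ g

  module _ (n : ℕ) .{{_ : NonZero n}} where
    _⊕_ : Carrier × Fin n → Carrier × Fin n → Carrier × Fin n
    (g , x) ⊕ (h , y) = (g ∙ h , x +ₙ y)

    RespectsG : ∀ {k} → (Carrier × Fin n → Fin k) → Set (a Level.⊔ ℓ)
    RespectsG c = ∀ {g h} (x : Fin n) → g ≈ h → c (g , x) ≡ c (h , x)

    colorsOnFiber : ∀ {k} → (Carrier × Fin n → Fin k) → Carrier → Subset k
    colorsOnFiber c g = image (λ x → c (g , x))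

    Rainbow3AP : ∀ {k} → (Carrier × Fin n → Fin k) →
                 Carrier × Fin n → Carrier × Fin n → Set
    Rainbow3AP c u d =
      (¬ c u ≡ c (u ⊕ d)) × (¬ c u ≡ c ((u ⊕ d) ⊕ d)) ×
      (¬ c (u ⊕ d) ≡ c ((u ⊕ d) ⊕ d))

    NoRainbow3AP : ∀ {k} → (Carrier × Fin n → Fin k) → Set a
    NoRainbow3AP c = ∀ u d → ¬ Rainbow3AP c u d

-- Suppose two colours α ≠ β of P_g are missing from P_0. As |c(P_g)| ≤ |c(P_0)|, two colours
-- γ ≠ γ′ of P_0 are missing from P_g. Translating by (g⁻¹, t) moves P_g to P_0 and P_0 to
-- P_{g⁻¹}, so every point of P_g, point of P_0 and point of P_{g⁻¹} in arithmetic position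
-- span a 3-AP. Fix (g,x) of colour α and (0,z′) of colour γ′, and let W be the third term of
-- their 3-AP. Since n is odd, (g,y) of colour β and W also lie on a 3-AP, whose middle term
-- has a colour of P_0; avoiding rainbows in both forces c(W) = γ′. Finally the 3-AP with middle
-- term (0,z) of colour γ and last term W has colours (a colour of P_g), γ, γ′: a rainbow.
module Submission where

open import Defs
open import Data.Nat using (ℕ; NonZero; _%_; _≤_)
open import Data.Fin using (Fin)
open import Data.Fin.Subset using (∣_∣)
open import Data.Product using (_×_)
open import Relation.Binary.PropositionalEquality using (_≡_)
open import Algebra.Bundles using (AbelianGroup)

open import Data.Nat using (suc; _+_; _*_; _∸_; _/_; s≤s; _≤?_; _<_)
open import Data.Nat.Properties
  using (+-comm; +-assoc; +-suc; module ≤-Reasoning; *-suc; *-distribˡ-+; m+[n∸m]≡n; <⇒≤; ≰⇒>; ≤-trans; +-cancelʳ-≤)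
open import Data.Nat.DivMod
  using (_mod_; m%n<n; m<n⇒m%n≡m; [m+n]%n≡m%n; [m+kn]%n≡m%n; %-distribˡ-+; m≡m%n+[m/n]*n)
open import Data.Fin using (toℕ; _≟_; zero; suc)
open import Data.Fin.Properties using (toℕ-injective; toℕ<n; toℕ-fromℕ<; any?; suc-injective)
open import Data.Fin.Subset using (Subset; inside; outside; _∈_; _∉_; _∩_; ∁; Nonempty)
open import Data.Fin.Subset.Properties using (x∈p∩q⁻; x∈∁p⇒x∉p; ∩-comm; ⊆-antisym)
open import Data.Vec using ([]; _∷_; here; there)
open import Data.Vec.Properties using (lookup∘tabulate; []=⇒lookup; lookup⇒[]=)
open import Data.Product using (∃; ∃₂; _,_)
open import Data.Sum using (_⊎_; inj₁; inj₂)
open import Data.Empty using (⊥; ⊥-elim)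
open import Data.Nat.Tactic.RingSolver using (solve-∀)
open import Function using (_∘_)
open import Relation.Nullary using (¬_; yes; no; does; proof)
open import Relation.Nullary.Decidable using (dec-true)
open import Relation.Nullary.Reflects using (Reflects; invert)
open import Relation.Binary.PropositionalEquality
  using (_≢_; refl; sym; trans; cong; cong₂; subst; ≢-sym; module ≡-Reasoning)

module ℤₙ (n : ℕ) .{{_ : NonZero n}} where
  open ≡-Reasoning

  [_] : ℕ → Fin n
  [ m ] = m mod n

  toℕ-[] : ∀ m → toℕ [ m ] ≡ m % n
  toℕ-[] m = toℕ-fromℕ< (m%n<n m n)

  []-≡ : ∀ {m m′} → m % n ≡ m′ % n → [ m ] ≡ [ m′ ]
  []-≡ {m} {m′} eq = toℕ-injective (trans (toℕ-[] m) (trans eq (sym (toℕ-[] m′))))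

  [toℕ] : ∀ a → [ toℕ a ] ≡ a
  [toℕ] a = toℕ-injective (trans (toℕ-fromℕ< _) (m<n⇒m%n≡m (toℕ<n a)))

  []-+ₙ : ∀ m m′ → [ m ] +ₙ [ m′ ] ≡ [ m + m′ ]
  []-+ₙ m m′ = []-≡ (begin
    (toℕ [ m ] + toℕ [ m′ ]) % n  ≡⟨ cong₂ (λ p q → (p + q) % n) (toℕ-[] m) (toℕ-[] m′) ⟩
    (m % n + m′ % n) % n          ≡⟨ %-distribˡ-+ m m′ n ⟨
    (m + m′) % n                  ∎)

  +ₙ-[] : ∀ a m → a +ₙ [ m ] ≡ [ toℕ a + m ]
  +ₙ-[] a m = trans (cong (_+ₙ [ m ]) (sym ([toℕ] a))) ([]-+ₙ (toℕ a) m)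

  +ₙ-comm : ∀ a b → a +ₙ b ≡ b +ₙ a
  +ₙ-comm a b = cong [_] (+-comm (toℕ a) (toℕ b))

  [toℕ+]-surjective : ∀ a b → ∃ λ d → [ toℕ a + d ] ≡ b
  [toℕ+]-surjective a b = (n ∸ toℕ a) + toℕ b , (begin
    [ toℕ a + ((n ∸ toℕ a) + toℕ b) ] ≡⟨ cong [_] (+-assoc (toℕ a) _ _) ⟨
    [ toℕ a + (n ∸ toℕ a) + toℕ b ]   ≡⟨ cong (λ m → [ m + toℕ b ]) (m+[n∸m]≡n (<⇒≤ (toℕ<n a))) ⟩
    [ n + toℕ b ]                     ≡⟨ []-≡ (trans (cong (_% n) (+-comm n (toℕ b))) ([m+n]%n≡m%n (toℕ b) n)) ⟩
    [ toℕ b ]                         ≡⟨ [toℕ] b ⟩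
    b                                 ∎)

  +ₙ-solvable : ∀ a b → ∃ λ t → a +ₙ t ≡ b
  +ₙ-solvable a b with [toℕ+]-surjective a b
  ... | d , eq = [ d ] , trans (+ₙ-[] a d) eq

  -- For odd n, ½ is the inverse of 2 modulo n.
  ½ : ℕ
  ½ = suc (n / 2)

  ½+½≡1+n : n % 2 ≡ 1 → ½ + ½ ≡ suc n
  ½+½≡1+n odd = begin
    ½ + ½                    ≡⟨ suc+suc (n / 2) ⟩
    suc (1 + n / 2 * 2)      ≡⟨ cong (λ r → suc (r + n / 2 * 2)) odd ⟨
    suc (n % 2 + n / 2 * 2)  ≡⟨ cong suc (m≡m%n+[m/n]*n n 2) ⟨
    suc n                    ∎
    where
    suc+suc : ∀ q → suc q + suc q ≡ suc (1 + q * 2)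
    suc+suc = solve-∀

  +ₙ-twice-solvable : n % 2 ≡ 1 → ∀ a b → ∃ λ t → (a +ₙ t) +ₙ t ≡ b
  +ₙ-twice-solvable odd a b with [toℕ+]-surjective a b
  ... | d , eq = [ d * ½ ] , (begin
    (a +ₙ [ d * ½ ]) +ₙ [ d * ½ ]   ≡⟨ cong (_+ₙ [ d * ½ ]) (+ₙ-[] a (d * ½)) ⟩
    [ toℕ a + d * ½ ] +ₙ [ d * ½ ]  ≡⟨ []-+ₙ _ _ ⟩
    [ toℕ a + d * ½ + d * ½ ]       ≡⟨ cong [_] (+-assoc (toℕ a) _ _) ⟩
    [ toℕ a + (d * ½ + d * ½) ]     ≡⟨ cong (λ m → [ toℕ a + m ]) (*-distribˡ-+ d ½ ½) ⟨
    [ toℕ a + d * (½ + ½) ]         ≡⟨ cong (λ m → [ toℕ a + d * m ]) (½+½≡1+n odd) ⟩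
    [ toℕ a + d * suc n ]           ≡⟨ cong (λ m → [ toℕ a + m ]) (*-suc d n) ⟩
    [ toℕ a + (d + d * n) ]         ≡⟨ cong [_] (+-assoc (toℕ a) d (d * n)) ⟨
    [ toℕ a + d + d * n ]           ≡⟨ []-≡ ([m+kn]%n≡m%n (toℕ a + d) d n) ⟩
    [ toℕ a + d ]                   ≡⟨ eq ⟩
    b                               ∎)

  IsAP : Fin n → Fin n → Fin n → Set
  IsAP x m w = ∃ λ t → x +ₙ t ≡ m × m +ₙ t ≡ w

  AP-from-first-middle : ∀ x m → ∃ λ w → IsAP x m w
  AP-from-first-middle x m with +ₙ-solvable x m
  ... | t , x+t≡m = m +ₙ t , t , x+t≡m , refl

  AP-from-middle-last : ∀ m w → ∃ λ x → IsAP x m w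
  AP-from-middle-last m w with +ₙ-solvable m w
  ... | t , m+t≡w with +ₙ-solvable t m
  ...   | x , t+x≡m = x , t , trans (+ₙ-comm x t) t+x≡m , m+t≡w

  AP-from-first-last : n % 2 ≡ 1 → ∀ x w → ∃ λ m → IsAP x m w
  AP-from-first-last odd x w with +ₙ-twice-solvable odd x w
  ... | t , eq = x +ₙ t , t , refl , eq

image-∈⁺ : ∀ {m k} (f : Fin m → Fin k) x → f x ∈ image f
image-∈⁺ f x = lookup⇒[]= (f x) (image f) (trans
  (lookup∘tabulate (λ j → does (any? (λ y → f y ≟ j))) (f x))
  (dec-true (any? (λ y → f y ≟ f x)) (x , refl)))

image-∈⁻ : ∀ {m k} (f : Fin m → Fin k) {j} → j ∈ image f → ∃ λ x → f x ≡ j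
image-∈⁻ f {j} j∈ = invert (subst (Reflects _) (trans
  (sym (lookup∘tabulate (λ j → does (any? (λ x → f x ≟ j))) j))
  ([]=⇒lookup j∈)) (proof (any? (λ x → f x ≟ j))))

∉-image⇒≢ : ∀ {m k} {f : Fin m → Fin k} {j} → j ∉ image f → ∀ x → j ≢ f x
∉-image⇒≢ {f = f} j∉ x refl = j∉ (image-∈⁺ f x)

image-cong : ∀ {m k} {f g : Fin m → Fin k} → (∀ x → f x ≡ g x) → image f ≡ image g
image-cong {f = f} {g} f≗g = ⊆-antisym (⊆ f≗g) (⊆ (sym ∘ f≗g))
  where
  ⊆ : ∀ {f g : Fin _ → Fin _} → (∀ x → f x ≡ g x) → ∀ {j} → j ∈ image f → j ∈ image g
  ⊆ {f} {g} f≗g j∈ with image-∈⁻ f j∈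
  ... | x , refl = subst (_∈ image g) (sym (f≗g x)) (image-∈⁺ g x)

x∈p∖q⁻ : ∀ {k} {p q : Subset k} {x} → x ∈ p ∖ q → x ∈ p × x ∉ q
x∈p∖q⁻ {p = p} {q} x∈ with x∈p∩q⁻ p (∁ q) x∈
... | x∈p , x∈∁q = x∈p , x∈∁p⇒x∉p x∈∁q

∣p∖q∣+∣p∩q∣≡∣p∣ : ∀ {k} (p q : Subset k) → ∣ p ∖ q ∣ + ∣ p ∩ q ∣ ≡ ∣ p ∣
∣p∖q∣+∣p∩q∣≡∣p∣ []            []            = refl
∣p∖q∣+∣p∩q∣≡∣p∣ (inside ∷ p)  (inside ∷ q)  = trans (+-suc _ _) (cong suc (∣p∖q∣+∣p∩q∣≡∣p∣ p q))
∣p∖q∣+∣p∩q∣≡∣p∣ (inside ∷ p)  (outside ∷ q) = cong suc (∣p∖q∣+∣p∩q∣≡∣p∣ p q)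
∣p∖q∣+∣p∩q∣≡∣p∣ (outside ∷ p) (inside ∷ q)  = ∣p∖q∣+∣p∩q∣≡∣p∣ p q
∣p∖q∣+∣p∩q∣≡∣p∣ (outside ∷ p) (outside ∷ q) = ∣p∖q∣+∣p∩q∣≡∣p∣ p q

∣p∣≤∣q∣⇒∣p∖q∣≤∣q∖p∣ : ∀ {k} (p q : Subset k) → ∣ p ∣ ≤ ∣ q ∣ → ∣ p ∖ q ∣ ≤ ∣ q ∖ p ∣
∣p∣≤∣q∣⇒∣p∖q∣≤∣q∖p∣ p q ∣p∣≤∣q∣ = +-cancelʳ-≤ ∣ p ∩ q ∣ _ _ (begin
  ∣ p ∖ q ∣ + ∣ p ∩ q ∣  ≡⟨ ∣p∖q∣+∣p∩q∣≡∣p∣ p q ⟩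
  ∣ p ∣                  ≤⟨ ∣p∣≤∣q∣ ⟩
  ∣ q ∣                  ≡⟨ ∣p∖q∣+∣p∩q∣≡∣p∣ q p ⟨
  ∣ q ∖ p ∣ + ∣ q ∩ p ∣  ≡⟨ cong (λ s → ∣ q ∖ p ∣ + ∣ s ∣) (∩-comm q p) ⟩
  ∣ q ∖ p ∣ + ∣ p ∩ q ∣  ∎)
  where open ≤-Reasoning

0<∣p∣⇒Nonempty : ∀ {k} (p : Subset k) → 0 < ∣ p ∣ → Nonempty p
0<∣p∣⇒Nonempty (inside ∷ p)  _ = zero , here
0<∣p∣⇒Nonempty (outside ∷ p) 0<∣p∣ with 0<∣p∣⇒Nonempty p 0<∣p∣
... | x , x∈p = suc x , there x∈p

1<∣p∣⇒distinct : ∀ {k} (p : Subset k) → 1 < ∣ p ∣ → ∃₂ λ x y → x ∈ p × y ∈ p × x ≢ y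
1<∣p∣⇒distinct (inside ∷ p) (s≤s 0<∣p∣) with 0<∣p∣⇒Nonempty p 0<∣p∣
... | y , y∈p = zero , suc y , here , there y∈p , λ ()
1<∣p∣⇒distinct (outside ∷ p) 1<∣p∣ with 1<∣p∣⇒distinct p 1<∣p∣
... | x , y , x∈p , y∈p , x≢y = suc x , suc y , there x∈p , there y∈p , x≢y ∘ suc-injective

distinct-outside-image : ∀ {m k} (f : Fin m → Fin k) (q : Subset k) →
  1 < ∣ image f ∖ q ∣ → ∃₂ λ x y → f x ∉ q × f y ∉ q × f x ≢ f y
distinct-outside-image f q 1<∣f∖q∣ with 1<∣p∣⇒distinct (image f ∖ q) 1<∣f∖q∣
... | i , j , i∈ , j∈ , i≢j with x∈p∖q⁻ {p = image f} i∈ | x∈p∖q⁻ {p = image f} j∈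
...   | i∈f , i∉q | j∈f , j∉q with image-∈⁻ f i∈f | image-∈⁻ f j∈f
...     | x , refl | y , refl = x , y , i∉q , j∉q , i≢j

not-rainbow⇒ : ∀ {k} {p q r : Fin k} → ¬ (p ≢ q × p ≢ r × q ≢ r) → p ≢ q → r ≡ p ⊎ r ≡ q
not-rainbow⇒ {p = p} {q} {r} not-rainbow p≢q with p ≟ r | q ≟ r
... | yes p≡r | _       = inj₁ (sym p≡r)
... | no _    | yes q≡r = inj₂ (sym q≡r)
... | no p≢r  | no q≢r  = ⊥-elim (not-rainbow (p≢q , p≢r , q≢r))

module Colouring {a ℓ} (G : AbelianGroup a ℓ) {n : ℕ} .{{_ : NonZero n}} {k : ℕ}
                 (c : AbelianGroup.Carrier G × Fin n → Fin k) where
  open AbelianGroup G using (Carrier; _≈_; _∙_)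
  open ℤₙ n

  colours : Carrier → Subset k
  colours = colorsOnFiber G n c

  colours-cong : RespectsG G n c → ∀ {g h} → g ≈ h → colours g ≡ colours h
  colours-cong respects g≈h = image-cong (λ x → respects x g≈h)

  module _ (odd : n % 2 ≡ 1) (no-rainbow : NoRainbow3AP G n c) (g h : Carrier) where

    not-rainbow-across : ∀ {x m w} → IsAP x m w →
      ¬ (c (g , x) ≢ c (g ∙ h , m) × c (g , x) ≢ c (g ∙ h ∙ h , w) × c (g ∙ h , m) ≢ c (g ∙ h ∙ h , w))
    not-rainbow-across {x} (t , refl , refl) = no-rainbow (g , x) (h , t)

    two-way-difference-impossible : ∀ {x y z z′} →
      c (g , x) ∉ colours (g ∙ h) → c (g , y) ∉ colours (g ∙ h) → c (g , x) ≢ c (g , y) →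
      c (g ∙ h , z) ∉ colours g → c (g ∙ h , z′) ∉ colours g → c (g ∙ h , z) ≢ c (g ∙ h , z′) → ⊥
    two-way-difference-impossible {x} {y} {z} {z′} x∉ y∉ x≢y z∉ z′∉ z≢z′
      with AP-from-first-middle x z′
    ... | w , ap₁ with AP-from-first-last odd y w | AP-from-middle-last z w
    ...   | m , ap₂ | u , ap₃ = not-rainbow-across ap₃
            ( ≢-sym (∉-image⇒≢ z∉ u)
            , (λ eq → ∉-image⇒≢ z′∉ u (trans (sym last≡z′) (sym eq)))
            , (λ eq → z≢z′ (trans eq last≡z′)) )
      where
      last≡z′ : c (g ∙ h ∙ h , w) ≡ c (g ∙ h , z′)
      last≡z′ with not-rainbow⇒ (not-rainbow-across ap₁) (∉-image⇒≢ x∉ z′)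
                 | not-rainbow⇒ (not-rainbow-across ap₂) (∉-image⇒≢ y∉ m)
      ... | inj₂ last≡z′ | _           = last≡z′
      ... | inj₁ last≡x  | inj₁ last≡y = ⊥-elim (x≢y (trans (sym last≡x) last≡y))
      ... | inj₁ last≡x  | inj₂ last≡m = ⊥-elim (∉-image⇒≢ x∉ m (trans (sym last≡x) last≡m))

    ¬two-way-difference : 1 < ∣ colours g ∖ colours (g ∙ h) ∣ → 1 < ∣ colours (g ∙ h) ∖ colours g ∣ → ⊥
    ¬two-way-difference 1<∣g∖gh∣ 1<∣gh∖g∣
      with distinct-outside-image (λ x → c (g , x)) _ 1<∣g∖gh∣
         | distinct-outside-image (λ z → c (g ∙ h , z)) _ 1<∣gh∖g∣
    ... | x , y , x∉ , y∉ , x≢y | z , z′ , z∉ , z′∉ , z≢z′ =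
      two-way-difference-impossible x∉ y∉ x≢y z∉ z′∉ z≢z′

lemma6 : ∀ {a ℓ} (G : AbelianGroup a ℓ) → IsFinite G →
         (n : ℕ) .{{_ : NonZero n}} → n % 2 ≡ 1 →
         (k : ℕ) (c : AbelianGroup.Carrier G × Fin n → Fin k) →
         RespectsG G n c →
         (∀ g → ∣ colorsOnFiber G n c g ∣ ≤ ∣ colorsOnFiber G n c (AbelianGroup.ε G) ∣) →
         NoRainbow3AP G n c →
         ∀ g → ∣ _∖_ (colorsOnFiber G n c g) (colorsOnFiber G n c (AbelianGroup.ε G)) ∣ ≤ 1
lemma6 G _ n odd _ c respects bounded no-rainbow g
  with ∣ colorsOnFiber G n c g ∖ colorsOnFiber G n c (AbelianGroup.ε G) ∣ ≤? 1
... | yes small = small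
... | no ¬small = ⊥-elim (¬two-way-difference odd no-rainbow g (g ⁻¹)
                    (subst (λ s → 1 < ∣ colours g ∖ s ∣) ε≡gg⁻¹ 1<∣g∖ε∣)
                    (subst (λ s → 1 < ∣ s ∖ colours g ∣) ε≡gg⁻¹ 1<∣ε∖g∣))
  where
  open AbelianGroup G using (ε; _⁻¹; _∙_; inverseʳ)
  open Colouring G c

  1<∣g∖ε∣ : 1 < ∣ colours g ∖ colours ε ∣
  1<∣g∖ε∣ = ≰⇒> ¬small

  1<∣ε∖g∣ : 1 < ∣ colours ε ∖ colours g ∣
  1<∣ε∖g∣ = ≤-trans 1<∣g∖ε∣ (∣p∣≤∣q∣⇒∣p∖q∣≤∣q∖p∣ (colours g) (colours ε) (bounded g))

  ε≡gg⁻¹ : colours ε ≡ colours (g ∙ g ⁻¹)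
  ε≡gg⁻¹ = sym (colours-cong respects (inverseʳ g))
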